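{- Let $\tau=a_1a_2\cdots a_n$ be a permutation which, in the quasi-consecutive pattern poset, covers precisely two permutations. Then at least one of the following holds: (i) $a_1$ and $a_2$ are consecutive integers (i.e. $|a_1-a_2|=1$); (ii) $\tau=1\,n\,(n-1)\cdots 3\,2$ or $\tau=n\,1\,2\cdots(n-1)$.
   Context: Permutations are written in one-line notation. For permutations $\sigma$ of length $m$ and $\tau=a_1a_2\cdots a_n$ of length $n$, an occurrence of $\sigma$ in $\tau$ (as a quasi-consecutive pattern) is a sequence of positions $1\le i_1<i_2<\cdots<i_m\le n$ such that $i_{j+1}=i_j+1$ for all $2\le j\le m-1$ and $a_{i_1}\cdots a_{i_m}$ is order-isomorphic to $\sigma$; thus all entries of the occurrence are adjacent in $\tau$ except possibly the first and second. The quasi-consecutive pattern poset is the set of all finite permutations ordered by $\sigma\le\tau$ iff $\tau$ contains an occurrence of $\sigma$. $\tau$ covers $\rho$ if $\rho<\tau$ and no $\alpha$ satisfies $\rho<\alpha<\tau$ (equivalently, $\rho\le\tau$ and $\rho$ has length one less than $\tau$). -}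

module Defs where

open import Data.Nat using (ℕ; zero; suc; _+_; _∸_; _<_; _≤_)
open import Data.List using (List; []; _∷_; length; map; upTo; take; drop; reverse)
open import Data.List.Relation.Binary.Pointwise using (Pointwise)
open import Data.List.Relation.Binary.Permutation.Propositional using (_↭_)
open import Data.Product using (Σ; ∃; _×_; _,_)
open import Data.Sum using (_⊎_)
open import Data.Unit using (⊤)
open import Relation.Nullary using (¬_)
open import Relation.Binary.PropositionalEquality using (_≡_; _≢_)
open import Function.Bundles using (_⇔_)

IsPerm : List ℕ → Set
IsPerm xs = xs ↭ map suc (upTo (length xs))

-- Order-isomorphism of two sequences of equal length:
-- for every pair of positions p < q, x_p < x_q iff y_p < y_q and
-- x_q < x_p iff y_q < y_p.
data OrdIso : List ℕ → List ℕ → Set where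
  []  : OrdIso [] []
  _∷_ : ∀ {x y xs ys} →
        Pointwise (λ x′ y′ → ((x < x′) ⇔ (y < y′)) × ((x′ < x) ⇔ (y′ < y))) xs ys →
        OrdIso xs ys → OrdIso (x ∷ xs) (y ∷ ys)

-- Positions are 0-indexed:
-- the first entry is at position i, the remaining m-1 entries form the
-- consecutive block at positions j, j+1, ..., j+m-2, with i < j.
Occurs : List ℕ → List ℕ → Set
Occurs [] τ = ⊤
Occurs (s ∷ σ′) τ =
  Σ ℕ λ i → Σ ℕ λ j → i < j × (j + length σ′ ≤ length τ) ×
    Σ ℕ λ x → Σ (List ℕ) λ rest → (drop i τ ≡ x ∷ rest) ×
      OrdIso (s ∷ σ′) (x ∷ take (length σ′) (drop j τ))

_≼_ : List ℕ → List ℕ → Set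
σ ≼ τ = Occurs σ τ

Covers : List ℕ → List ℕ → Set
Covers τ ρ = IsPerm ρ × (ρ ≼ τ) × (ρ ≢ τ) ×
  (∀ α → IsPerm α → ρ ≼ α → α ≼ τ → (α ≡ ρ) ⊎ (α ≡ τ))

CoversExactlyTwo : List ℕ → Set
CoversExactlyTwo τ = Σ (List ℕ) λ ρ₁ → Σ (List ℕ) λ ρ₂ → (ρ₁ ≢ ρ₂) ×
  Covers τ ρ₁ × Covers τ ρ₂ × (∀ ρ → Covers τ ρ → (ρ ≡ ρ₁) ⊎ (ρ ≡ ρ₂))

oneThenDecreasing : ℕ → List ℕ
oneThenDecreasing n = 1 ∷ reverse (map (2 +_) (upTo (n ∸ 1)))

nThenIncreasing : ℕ → List ℕ
nThenIncreasing n = n ∷ map suc (upTo (n ∸ 1))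

FirstTwoConsecutive : List ℕ → Set
FirstTwoConsecutive τ = Σ ℕ λ a₁ → Σ ℕ λ a₂ → Σ (List ℕ) λ rest →
  (τ ≡ a₁ ∷ a₂ ∷ rest) × ((a₂ ≡ suc a₁) ⊎ (a₁ ≡ suc a₂))

module Submission where

-- Deleting a₁, a₂ or a_n and
-- standardising the remaining entries yields three permutations d₁, d₂, dₙ
-- that occur in τ as quasi-consecutive patterns (the remaining entries are
-- one entry followed by a consecutive block), and every pattern of τ that is
-- one entry shorter is covered by τ.  If τ covers only two permutations, two
-- of d₁, d₂, dₙ coincide:
--   d₁ = d₂: no entry lies between a₁ and a₂, so they are consecutive;
--   d₁ = dₙ: a₂ ⋯ a_n is ordered like a₁ ⋯ a_{n-1}, which forces τ to be
--            monotone, so again a₁ and a₂ are consecutive;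
--   d₂ = dₙ: a₂ ⋯ a_n is monotone and a₁ lies on the same side of a₂ as of
--            a_n, giving (i), or τ = n 1 2 ⋯ (n-1), or τ = 1 n (n-1) ⋯ 2.
-- The file first develops intervals and permutations, the rank of an entry
-- (which shows that order-isomorphic permutations are equal), lowering by a
-- deleted value, and the covering of one-shorter patterns; then monotone
-- lists inside an interval; then the three deletions and the case analysis.

open import Defs
open import Data.List using (List; []; _∷_; length; map; upTo; applyUpTo; reverse; filter; drop; take; _++_; [_])
open import Data.List.Properties using (∷-injective; map-id; map-applyUpTo; map-++; length-map; reverse-++; take-all; ++-identityʳ; filter-accept; filter-reject; filter-none)
open import Data.List.Membership.Propositional using (_∈_)
open import Data.List.Membership.Propositional.Properties using (∈-++⁺ʳ)
open import Data.List.Relation.Unary.Any using (here; there)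
open import Data.List.Relation.Unary.All as All using (All; []; _∷_)
open import Data.List.Relation.Unary.Linked as Linked using (Linked; []; [-]; _∷_)
open import Data.List.Relation.Unary.Linked.Properties using (Linked⇒All)
open import Data.List.Relation.Unary.Unique.Propositional using (Unique; []; _∷_)
open import Data.List.Relation.Binary.Pointwise using (Pointwise; []; _∷_; Pointwise-≡⇒≡) renaming (map to Pointwise-map)
open import Data.List.Relation.Binary.Permutation.Propositional using (_↭_; ↭-sym; ↭-refl; ↭-trans; ↭-swap; ↭⇒↭ₛ)
open import Data.List.Relation.Binary.Permutation.Propositional.Properties using (∈-resp-↭; drop-mid; map⁺; filter-↭; ↭-length)
import Data.List.Relation.Binary.Permutation.Setoid.Properties as SetoidPermutation
open import Data.Nat using (ℕ; zero; suc; _+_; _∸_; _<_; _≤_; _>_; z≤n; s≤s; pred; _<?_; _≟_)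
open import Data.Nat.Properties
open import Data.Product using (_×_; _,_; proj₁; proj₂)
open import Data.Sum using (_⊎_; inj₁; inj₂)
open import Data.Empty using (⊥-elim)
open import Relation.Nullary using (¬_; yes; no)
open import Relation.Binary.Core using (_⇒_)
open import Relation.Binary.Definitions using (Transitive; Reflexive; tri<; tri≈; tri>)
open import Function.Base using (_∘_)
open import Function.Bundles using (_⇔_; mk⇔; Equivalence)
import Function.Properties.Equivalence as ⇔
open import Data.Unit using (⊤; tt)
open import Relation.Binary.PropositionalEquality using (_≡_; _≢_; ≢-sym; refl; sym; trans; cong; cong₂; subst; subst₂; setoid; module ≡-Reasoning)

interval : ℕ → ℕ → List ℕ
interval a zero    = []
interval a (suc k) = a ∷ interval (suc a) k

-- Any enumeration a, a+1, ..., a+k-1 written with applyUpTo is the interval;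
-- this connects the statement's `map suc (upTo n)` with `interval 1 n`.
applyUpTo-interval : ∀ (f : ℕ → ℕ) a k → (∀ i → f i ≡ a + i) → applyUpTo f k ≡ interval a k
applyUpTo-interval f a zero    f≗a+ = refl
applyUpTo-interval f a (suc k) f≗a+ = cong₂ _∷_ (trans (f≗a+ 0) (+-identityʳ a))
  (applyUpTo-interval (λ i → f (suc i)) (suc a) k (λ i → trans (f≗a+ (suc i)) (+-suc a i)))

shiftedUpTo-interval : ∀ a k → map (a +_) (upTo k) ≡ interval a k
shiftedUpTo-interval a k = trans (map-applyUpTo (λ i → i) (a +_) k) (applyUpTo-interval (a +_) a k (λ i → refl))

∈-interval⁻ : ∀ {x} a k → x ∈ interval a k → a ≤ x × x < a + k
∈-interval⁻ a (suc k) (here refl) = ≤-refl , m<m+n a (s≤s z≤n)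
∈-interval⁻ {x} a (suc k) (there x∈) with ∈-interval⁻ (suc a) k x∈
... | a<x , x<a+1+k = <⇒≤ a<x , subst (x <_) (sym (+-suc a k)) x<a+1+k

∈-interval⁺ : ∀ {x} a k → a ≤ x → x < a + k → x ∈ interval a k
∈-interval⁺ {x} a zero a≤x x<a+0 = ⊥-elim (<-irrefl refl (≤-<-trans a≤x (subst (x <_) (+-identityʳ a) x<a+0)))
∈-interval⁺ {x} a (suc k) a≤x x<a+1+k with m≤n⇒m<n∨m≡n a≤x
... | inj₂ refl = here refl
... | inj₁ a<x  = there (∈-interval⁺ (suc a) k a<x (subst (x <_) (+-suc a k) x<a+1+k))

interval-++ : ∀ a i k → interval a i ++ interval (a + i) k ≡ interval a (i + k)
interval-++ a zero    k = cong (λ b → interval b k) (+-identityʳ a)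
interval-++ a (suc i) k = cong (a ∷_)
  (trans (cong (λ b → interval (suc a) i ++ interval b k) (+-suc a i)) (interval-++ (suc a) i k))

reverse-interval : ∀ a k → reverse (interval a (suc k)) ≡ (a + k) ∷ reverse (interval a k)
reverse-interval a k = begin
  reverse (interval a (suc k))             ≡⟨ cong (λ m → reverse (interval a m)) (+-comm 1 k) ⟩
  reverse (interval a (k + 1))             ≡⟨ cong reverse (interval-++ a k 1) ⟨
  reverse (interval a k ++ [ a + k ])      ≡⟨ reverse-++ (interval a k) [ a + k ] ⟩
  (a + k) ∷ reverse (interval a k)         ∎
  where open ≡-Reasoning

interval-unique : ∀ a k → Unique (interval a k)
interval-unique a zero    = []
interval-unique a (suc k) =
  All.tabulate (λ x∈ a≡x → <-irrefl a≡x (proj₁ (∈-interval⁻ (suc a) k x∈))) ∷ interval-unique (suc a) k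

perm⇒interval : ∀ {xs} → IsPerm xs → xs ↭ interval 1 (length xs)
perm⇒interval {xs} π = subst (xs ↭_) (shiftedUpTo-interval 1 (length xs)) π

interval⇒perm : ∀ {xs} m → xs ↭ interval 1 m → length xs ≡ m → IsPerm xs
interval⇒perm {xs} m xs↭ refl = subst (xs ↭_) (sym (shiftedUpTo-interval 1 m)) xs↭

perm-unique : ∀ {xs} → IsPerm xs → Unique xs
perm-unique π = SetoidPermutation.Unique-resp-↭ (setoid ℕ) (↭⇒↭ₛ (↭-sym (perm⇒interval π))) (interval-unique 1 _)

perm-bounds : ∀ {xs x} → IsPerm xs → x ∈ xs → 1 ≤ x × x ≤ length xs
perm-bounds π x∈ with ∈-interval⁻ 1 _ (∈-resp-↭ (perm⇒interval π) x∈)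
... | 1≤x , x<1+n = 1≤x , ≤-pred x<1+n

perm-complete : ∀ {xs x} → IsPerm xs → 1 ≤ x → x ≤ length xs → x ∈ xs
perm-complete π 1≤x x≤n = ∈-resp-↭ (↭-sym (perm⇒interval π)) (∈-interval⁺ 1 _ 1≤x (s≤s x≤n))

rank : ℕ → List ℕ → ℕ
rank x xs = length (filter (_<? x) xs)

rank-↭ : ∀ x {xs ys} → xs ↭ ys → rank x xs ≡ rank x ys
rank-↭ x xs↭ys = ↭-length (filter-↭ (_<? x) xs↭ys)

rank-∷-below : ∀ {x y} ys → y < x → rank x (y ∷ ys) ≡ suc (rank x ys)
rank-∷-below {x} ys y<x = cong length (filter-accept (_<? x) y<x)

rank-∷-notBelow : ∀ {x y} ys → ¬ y < x → rank x (y ∷ ys) ≡ rank x ys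
rank-∷-notBelow {x} ys y≮x = cong length (filter-reject (_<? x) y≮x)

rank-interval : ∀ x a k → a ≤ x → x ≤ a + k → a + rank x (interval a k) ≡ x
rank-interval x a zero a≤x x≤a+0 = trans (+-identityʳ a) (≤-antisym a≤x (subst (x ≤_) (+-identityʳ a) x≤a+0))
rank-interval x a (suc k) a≤x x≤a+1+k with a <? x
... | yes a<x = begin
  a + rank x (interval a (suc k))        ≡⟨ cong (a +_) (rank-∷-below (interval (suc a) k) a<x) ⟩
  a + suc (rank x (interval (suc a) k))  ≡⟨ +-suc a _ ⟩
  suc a + rank x (interval (suc a) k)    ≡⟨ rank-interval x (suc a) k a<x (subst (x ≤_) (+-suc a k) x≤a+1+k) ⟩
  x                                      ∎
  where open ≡-Reasoning
... | no  a≮x = begin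
  a + rank x (interval a (suc k))        ≡⟨ cong (a +_) (rank-∷-notBelow (interval (suc a) k) a≮x) ⟩
  a + rank x (interval (suc a) k)        ≡⟨ cong (λ r → a + length r) (filter-none (_<? x) nothingBelow) ⟩
  a + 0                                  ≡⟨ +-identityʳ a ⟩
  a                                      ≡⟨ a≡x ⟩
  x                                      ∎
  where
  open ≡-Reasoning
  a≡x : a ≡ x
  a≡x = ≤-antisym a≤x (≮⇒≥ a≮x)
  nothingBelow : All (λ y → ¬ y < x) (interval (suc a) k)
  nothingBelow = All.tabulate λ y∈ y<x → a≮x (<-trans (proj₁ (∈-interval⁻ (suc a) k y∈)) y<x)

perm-value : ∀ {xs x} → IsPerm xs → x ∈ xs → x ≡ suc (rank x xs)
perm-value {xs} {x} π x∈ with perm-bounds π x∈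
... | 1≤x , x≤n =
  sym (trans (cong suc (rank-↭ x (perm⇒interval π))) (rank-interval x 1 (length xs) 1≤x (m≤n⇒m≤1+n x≤n)))

rank-step : ∀ {x y x′ y′ xs ys} → (x < x′) ⇔ (y < y′) → rank x′ xs ≡ rank y′ ys →
  rank x′ (x ∷ xs) ≡ rank y′ (y ∷ ys)
rank-step {x} {y} {x′} {y′} {xs} {ys} x<x′⇔y<y′ same with x <? x′
... | yes x<x′ = begin
  rank x′ (x ∷ xs)   ≡⟨ rank-∷-below xs x<x′ ⟩
  suc (rank x′ xs)   ≡⟨ cong suc same ⟩
  suc (rank y′ ys)   ≡⟨ rank-∷-below ys (Equivalence.to x<x′⇔y<y′ x<x′) ⟨
  rank y′ (y ∷ ys)   ∎
  where open ≡-Reasoning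
... | no x≮x′ = begin
  rank x′ (x ∷ xs)   ≡⟨ rank-∷-notBelow xs x≮x′ ⟩
  rank x′ xs         ≡⟨ same ⟩
  rank y′ ys         ≡⟨ rank-∷-notBelow ys (λ y<y′ → x≮x′ (Equivalence.from x<x′⇔y<y′ y<y′)) ⟨
  rank y′ (y ∷ ys)   ∎
  where open ≡-Reasoning

rank-cong : ∀ {x y xs ys} → Pointwise (λ x′ y′ → (x′ < x) ⇔ (y′ < y)) xs ys → rank x xs ≡ rank y ys
rank-cong []                    = refl
rank-cong (x′<x⇔y′<y ∷ related) = rank-step x′<x⇔y′<y (rank-cong related)

ordIso-rank : ∀ {xs ys} → OrdIso xs ys → Pointwise (λ x y → rank x xs ≡ rank y ys) xs ys
ordIso-rank []                                  = []
ordIso-rank {x ∷ xs} {y ∷ ys} (related ∷ iso) =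
  rank-step {x} {y} {x} {y} {xs} {ys} (mk⇔ (λ x<x → ⊥-elim (<-irrefl refl x<x)) (λ y<y → ⊥-elim (<-irrefl refl y<y)))
            (rank-cong (Pointwise-map proj₂ related))
  ∷ ranksAfter related (ordIso-rank iso)
  where
  ranksAfter : ∀ {xs′ ys′} →
    Pointwise (λ x′ y′ → ((x < x′) ⇔ (y < y′)) × ((x′ < x) ⇔ (y′ < y))) xs′ ys′ →
    Pointwise (λ x′ y′ → rank x′ xs ≡ rank y′ ys) xs′ ys′ →
    Pointwise (λ x′ y′ → rank x′ (x ∷ xs) ≡ rank y′ (y ∷ ys)) xs′ ys′
  ranksAfter []                        []                = []
  ranksAfter ((x<x′⇔y<y′ , _) ∷ related′) (same ∷ ranks) = rank-step x<x′⇔y<y′ same ∷ ranksAfter related′ ranks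

-- Rigidity: two order-isomorphic permutations are equal, since every
-- entry of a permutation is determined by its rank.
ordIso-perm-≡ : ∀ {xs ys} → IsPerm xs → IsPerm ys → OrdIso xs ys → xs ≡ ys
ordIso-perm-≡ {xs} {ys} πx πy iso =
  Pointwise-≡⇒≡ (equalValues (All.tabulate (perm-value πx)) (All.tabulate (perm-value πy)) (ordIso-rank iso))
  where
  equalValues : ∀ {xs′ ys′} → All (λ x → x ≡ suc (rank x xs)) xs′ → All (λ y → y ≡ suc (rank y ys)) ys′ →
    Pointwise (λ x y → rank x xs ≡ rank y ys) xs′ ys′ → Pointwise _≡_ xs′ ys′
  equalValues []             []             []            = []
  equalValues (x≡ ∷ xValues) (y≡ ∷ yValues) (same ∷ ranks) =
    trans x≡ (trans (cong suc same) (sym y≡)) ∷ equalValues xValues yValues ranks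

-- Standardising after deleting the value v: entries above v move down by one.
lower : ℕ → ℕ → ℕ
lower v y with v <? y
... | yes _ = pred y
... | no  _ = y

lower-above : ∀ {u y} → u < y → lower u y ≡ pred y
lower-above {u} {y} u<y with u <? y
... | yes _   = refl
... | no  u≮y = ⊥-elim (u≮y u<y)

lower-notAbove : ∀ {v y} → ¬ v < y → lower v y ≡ y
lower-notAbove {v} {y} v≮y with v <? y
... | yes v<y = ⊥-elim (v≮y v<y)
... | no  _   = refl

data LowerView (v y : ℕ) : Set where
  above : v < y → lower v y ≡ pred y → LowerView v y
  below : y < v → lower v y ≡ y → LowerView v y

lowerView : ∀ {v y} → v ≢ y → LowerView v y
lowerView {v} {y} v≢y with v <? y
... | yes v<y = above v<y (lower-above v<y)
... | no  v≮y = below (≤∧≢⇒< (≮⇒≥ v≮y) (≢-sym v≢y)) (lower-notAbove v≮y)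

OrderEmbeddingOn : (ℕ → Set) → (ℕ → ℕ) → Set
OrderEmbeddingOn P f = ∀ {y z} → P y → P z → (y < z) ⇔ (f y < f z)

identity-embedding : OrderEmbeddingOn (λ _ → ⊤) (λ y → y)
identity-embedding _ _ = ⇔.refl

lower-embedding : ∀ v → OrderEmbeddingOn (v ≢_) (lower v)
lower-embedding v v≢y v≢z with lowerView v≢y | lowerView v≢z
... | above v<y ly | above v<z lz rewrite ly | lz = predecessors (<-≤-trans (s≤s z≤n) v<y) (<-≤-trans (s≤s z≤n) v<z)
  where
  predecessors : ∀ {y z} → 0 < y → 0 < z → (y < z) ⇔ (pred y < pred z)
  predecessors (s≤s _) (s≤s _) = mk⇔ ≤-pred s≤s
... | above v<y ly | below z<v lz rewrite ly | lz =
  mk⇔ (λ y<z → ⊥-elim (<-asym y<z (<-trans z<v v<y)))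
      (λ y-1<z → ⊥-elim (<-asym y-1<z (<-≤-trans z<v (<⇒≤pred v<y))))
... | below y<v ly | above v<z lz rewrite ly | lz =
  mk⇔ (λ _ → <-≤-trans y<v (<⇒≤pred v<z)) (λ _ → <-trans y<v v<z)
... | below _ ly | below _ lz rewrite ly | lz = ⇔.refl

sameImage⇒ordIso : ∀ {P Q f g xs ys} → OrderEmbeddingOn P f → OrderEmbeddingOn Q g →
  All P xs → All Q ys → map f xs ≡ map g ys → OrdIso xs ys
sameImage⇒ordIso embF embG [] [] refl = []
sameImage⇒ordIso {P} {Q} {f} {g} embF embG (px ∷ pxs) (qy ∷ qys) fx∷≡gy∷
  with fx≡gy , images ← ∷-injective fx∷≡gy∷ =
  related pxs qys images ∷ sameImage⇒ordIso embF embG pxs qys images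
  where
  compareAlike : ∀ {a b c d} → P a → P b → Q c → Q d → f a ≡ g c → f b ≡ g d → (a < b) ⇔ (c < d)
  compareAlike pa pb qc qd fa≡gc fb≡gd =
    ⇔.trans (embF pa pb) (⇔.trans (subst₂ (λ l r → (f _ < f _) ⇔ (l < r)) fa≡gc fb≡gd ⇔.refl) (⇔.sym (embG qc qd)))
  related : ∀ {xs′ ys′} → All P xs′ → All Q ys′ → map f xs′ ≡ map g ys′ →
    Pointwise (λ x′ y′ → ((_ < x′) ⇔ (_ < y′)) × ((x′ < _) ⇔ (y′ < _))) xs′ ys′
  related [] [] refl = []
  related (px′ ∷ pxs′) (qy′ ∷ qys′) fx′∷≡gy′∷ with fx′≡gy′ , images′ ← ∷-injective fx′∷≡gy′∷ =
    (compareAlike px px′ qy qy′ fx≡gy fx′≡gy′ , compareAlike px′ px qy′ qy fx′≡gy′ fx≡gy)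
    ∷ related pxs′ qys′ images′

lowering-ordIso : ∀ v {xs} → All (v ≢_) xs → OrdIso (map (lower v) xs) xs
lowering-ordIso v {xs} notV = sameImage⇒ordIso identity-embedding (lower-embedding v)
  (All.universal (λ _ → tt) _) notV (map-id (map (lower v) xs))

occurs-length : ∀ σ τ → σ ≼ τ → length σ ≤ length τ
occurs-length []       τ _                          = z≤n
occurs-length (s ∷ σ′) τ (i , j , i<j , fits , _) =
  ≤-trans (s≤s (m≤n+m (length σ′) i)) (≤-trans (+-monoˡ-≤ (length σ′) i<j) fits)

occurs-full : ∀ σ τ → σ ≼ τ → length σ ≡ length τ → OrdIso σ τ
occurs-full []       []      _ _ = []
occurs-full []       (_ ∷ _) _ ()
occurs-full (s ∷ σ′) _ (zero , suc zero , _ , _ , x , rest , refl , iso) sameLength =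
  subst (λ r → OrdIso (s ∷ σ′) (x ∷ r)) (take-all (length σ′) rest (≤-reflexive (sym (suc-injective sameLength)))) iso
occurs-full (s ∷ σ′) τ (_ , suc (suc j) , _ , fits , _) sameLength =
  ⊥-elim (<-irrefl refl (≤-trans (s≤s (s≤s (m≤n+m (length σ′) j))) (subst (_ ≤_) (sym sameLength) fits)))
occurs-full (s ∷ σ′) τ (suc i , suc zero , s≤s () , _) _

-- A pattern of τ that is one entry shorter than τ is covered by τ:
-- a permutation strictly between them would have no length left.
oneShorter-covered : ∀ {τ ρ} → IsPerm τ → IsPerm ρ → ρ ≼ τ → suc (length ρ) ≡ length τ → Covers τ ρ
oneShorter-covered {τ} {ρ} πτ πρ ρ≼τ longer = πρ , ρ≼τ , ρ≢τ , nothingBetween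
  where
  ρ≢τ : ρ ≢ τ
  ρ≢τ ρ≡τ = 1+n≢n (trans longer (cong length (sym ρ≡τ)))
  nothingBetween : ∀ α → IsPerm α → ρ ≼ α → α ≼ τ → (α ≡ ρ) ⊎ (α ≡ τ)
  nothingBetween α πα ρ≼α α≼τ with m≤n⇒m<n∨m≡n (occurs-length α τ α≼τ)
  ... | inj₂ |α|≡|τ| = inj₂ (ordIso-perm-≡ πα πτ (occurs-full α τ α≼τ |α|≡|τ|))
  ... | inj₁ |α|<|τ| = inj₁ (sym (ordIso-perm-≡ πρ πα (occurs-full ρ α ρ≼α |ρ|≡|α|)))
    where
    |ρ|≡|α| : length ρ ≡ length α
    |ρ|≡|α| = ≤-antisym (occurs-length ρ α ρ≼α) (≤-pred (subst (length α <_) (sym longer) |α|<|τ|))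

take-prefix : ∀ (xs ys : List ℕ) → take (length xs) (xs ++ ys) ≡ xs
take-prefix []       ys = refl
take-prefix (x ∷ xs) ys = cong (x ∷_) (take-prefix xs ys)

lowering-occurs : ∀ {τ i j x rest block tail} v → i < j → j + length block ≤ length τ →
  drop i τ ≡ x ∷ rest → drop j τ ≡ block ++ tail → All (v ≢_) (x ∷ block) → map (lower v) (x ∷ block) ≼ τ
lowering-occurs {τ} {i} {j} {x} {rest} {block} {tail} v i<j fits atI atJ notV =
  i , j , i<j , subst (λ l → j + l ≤ length τ) (sym (length-map (lower v) block)) fits , x , rest , atI ,
  subst (λ b → OrdIso (map (lower v) (x ∷ block)) (x ∷ b)) (sym takeBlock) (lowering-ordIso v notV)
  where
  takeBlock : take (length (map (lower v) block)) (drop j τ) ≡ block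
  takeBlock = begin
    take (length (map (lower v) block)) (drop j τ)   ≡⟨ cong₂ take (length-map (lower v) block) atJ ⟩
    take (length block) (block ++ tail)              ≡⟨ take-prefix block tail ⟩
    block                                            ∎
    where open ≡-Reasoning

length-insert : ∀ (pre : List ℕ) v post → length (pre ++ v ∷ post) ≡ suc (length (pre ++ post))
length-insert []        v post = refl
length-insert (x ∷ pre) v post = cong suc (length-insert pre v post)

interval-around : ∀ u m → u ≤ m → interval 1 (suc m) ≡ interval 1 u ++ suc u ∷ interval (suc (suc u)) (m ∸ u)
interval-around u m u≤m = sym (trans (interval-++ 1 u (suc (m ∸ u)))
  (cong (interval 1) (trans (+-suc u (m ∸ u)) (cong suc (m+[n∸m]≡n u≤m)))))

lower-interval-below : ∀ v a k → a + k ≤ suc v → map (lower v) (interval a k) ≡ interval a k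
lower-interval-below v a zero    _       = refl
lower-interval-below v a (suc k) fitsBelow = cong₂ _∷_
  (lower-notAbove (λ v<a → <-irrefl refl (<-≤-trans v<a (≤-pred (≤-trans (s≤s (m≤m+n a k)) restFitsBelow)))))
  (lower-interval-below v (suc a) k restFitsBelow)
  where
  restFitsBelow : suc a + k ≤ suc v
  restFitsBelow = subst (_≤ suc v) (+-suc a k) fitsBelow

lower-interval-above : ∀ v a k → v < a → map (lower v) (interval a k) ≡ interval (pred a) k
lower-interval-above v a       zero    _   = refl
lower-interval-above v (suc a) (suc k) v<a = cong₂ _∷_ (lower-above v<a) (lower-interval-above v (suc (suc a)) k (m<n⇒m<1+n v<a))

lowering-removal : ∀ pre v post m → pre ++ v ∷ post ↭ interval 1 (suc m) → map (lower v) (pre ++ post) ↭ interval 1 m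
lowering-removal pre v post m τ↭ with ∈-interval⁻ 1 (suc m) (∈-resp-↭ τ↭ (∈-++⁺ʳ pre (here refl)))
lowering-removal pre (suc u) post m τ↭ | _ , s≤s (s≤s u≤m) =
  subst (map (lower (suc u)) (pre ++ post) ↭_) loweredInterval
    (map⁺ (lower (suc u)) (drop-mid pre (interval 1 u) (subst (pre ++ suc u ∷ post ↭_) (interval-around u m u≤m) τ↭)))
  where
  loweredInterval : map (lower (suc u)) (interval 1 u ++ interval (suc (suc u)) (m ∸ u)) ≡ interval 1 m
  loweredInterval = begin
    map (lower (suc u)) (interval 1 u ++ interval (suc (suc u)) (m ∸ u))
      ≡⟨ map-++ (lower (suc u)) (interval 1 u) _ ⟩
    map (lower (suc u)) (interval 1 u) ++ map (lower (suc u)) (interval (suc (suc u)) (m ∸ u))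
      ≡⟨ cong₂ _++_ (lower-interval-below (suc u) 1 u (n≤1+n (suc u)))
                    (lower-interval-above (suc u) (suc (suc u)) (m ∸ u) ≤-refl) ⟩
    interval 1 u ++ interval (suc u) (m ∸ u)
      ≡⟨ interval-++ 1 u (m ∸ u) ⟩
    interval 1 (u + (m ∸ u))
      ≡⟨ cong (interval 1) (m+[n∸m]≡n u≤m) ⟩
    interval 1 m
      ∎
    where open ≡-Reasoning

deletion-perm : ∀ pre v post → IsPerm (pre ++ v ∷ post) → IsPerm (map (lower v) (pre ++ post))
deletion-perm pre v post π = interval⇒perm (length (pre ++ post))
  (lowering-removal pre v post _ (subst (λ n → pre ++ v ∷ post ↭ interval 1 n) (length-insert pre v post) (perm⇒interval π)))
  (length-map (lower v) (pre ++ post))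

deletion-covered : ∀ pre v post → IsPerm (pre ++ v ∷ post) →
  map (lower v) (pre ++ post) ≼ (pre ++ v ∷ post) → Covers (pre ++ v ∷ post) (map (lower v) (pre ++ post))
deletion-covered pre v post π occ = oneShorter-covered π (deletion-perm pre v post π) occ
  (trans (cong suc (length-map (lower v) (pre ++ post))) (sym (length-insert pre v post)))

dropLast : ℕ → List ℕ → List ℕ
dropLast x []       = []
dropLast x (y ∷ ys) = x ∷ dropLast y ys

lastOf : ℕ → List ℕ → ℕ
lastOf x []       = x
lastOf x (y ∷ ys) = lastOf y ys

dropLast-lastOf : ∀ x xs → x ∷ xs ≡ dropLast x xs ++ [ lastOf x xs ]
dropLast-lastOf x []       = refl
dropLast-lastOf x (y ∷ ys) = cong (x ∷_) (dropLast-lastOf y ys)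

length-dropLast : ∀ x xs → length (dropLast x xs) ≡ length xs
length-dropLast x []       = refl
length-dropLast x (y ∷ ys) = cong suc (length-dropLast y ys)

unique-last : ∀ (xs : List ℕ) {z : ℕ} → Unique (xs ++ [ z ]) → All (z ≢_) xs
unique-last []       _                  = []
unique-last (x ∷ xs) (x≢rest ∷ unique) =
  ≢-sym (All.lookup x≢rest (∈-++⁺ʳ xs (here refl))) ∷ unique-last xs unique

-- If x ∷ xs is ordered like its own shift, i.e. xs is order isomorphic
-- to x ∷ xs without its last entry, then each comparison of neighbours
-- repeats the previous one, so x ∷ xs is monotone.
shifted-ascending : ∀ {x y rest} → x < y → OrdIso (y ∷ rest) (x ∷ dropLast y rest) → Linked _<_ (x ∷ y ∷ rest)
shifted-ascending {rest = []}    x<y _                                  = x<y ∷ [-]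
shifted-ascending {rest = _ ∷ _} x<y (((y<z⇔x<y , _) ∷ _) ∷ shifted) =
  x<y ∷ shifted-ascending (Equivalence.from y<z⇔x<y x<y) shifted

shifted-descending : ∀ {x y rest} → y < x → OrdIso (y ∷ rest) (x ∷ dropLast y rest) → Linked _>_ (x ∷ y ∷ rest)
shifted-descending {rest = []}    y<x _                                  = y<x ∷ [-]
shifted-descending {rest = _ ∷ _} y<x (((_ , z<y⇔y<x) ∷ _) ∷ shifted) =
  y<x ∷ shifted-descending (Equivalence.from z<y⇔y<x y<x) shifted

shifted-monotone : ∀ {x xs} → All (x ≢_) xs → OrdIso xs (dropLast x xs) → Linked _<_ (x ∷ xs) ⊎ Linked _>_ (x ∷ xs)
shifted-monotone {xs = []}    _          _       = inj₁ [-]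
shifted-monotone {x} {y ∷ _} (x≢y ∷ _) shifted with <-cmp x y
... | tri< x<y _   _   = inj₁ (shifted-ascending x<y shifted)
... | tri≈ _   x≡y _   = ⊥-elim (x≢y x≡y)
... | tri> _   _   y<x = inj₂ (shifted-descending y<x shifted)

>-trans : Transitive _>_
>-trans x>y y>z = <-trans y>z x>y

linked-head : ∀ {R : ℕ → ℕ → Set} → Transitive R → ∀ {x xs} → Linked R (x ∷ xs) → All (R x) xs
linked-head R-trans [-]            = []
linked-head R-trans (Rxy ∷ linked) = Linked⇒All R-trans Rxy linked

linked-last : ∀ {R S : ℕ → ℕ → Set} → R ⇒ S → Transitive S → Reflexive S →
  ∀ {x xs} → Linked R (x ∷ xs) → All (λ y → S y (lastOf x xs)) (x ∷ xs)
linked-last R⇒S S-trans S-refl [-]            = S-refl ∷ []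
linked-last R⇒S S-trans S-refl (Rxy ∷ linked) with toLast@(Sy ∷ _) ← linked-last R⇒S S-trans S-refl linked =
  S-trans (R⇒S Rxy) Sy ∷ toLast

All-last : ∀ {P : ℕ → Set} {x xs} → All P (x ∷ xs) → P (lastOf x xs)
All-last (px ∷ [])         = px
All-last (_ ∷ py ∷ pys) = All-last (py ∷ pys)

ascending-spread : ∀ {h t} → Linked _<_ (h ∷ t) → h + length t ≤ lastOf h t
ascending-spread {h} [-]              = ≤-reflexive (+-identityʳ h)
ascending-spread {h} {h′ ∷ t} (h<h′ ∷ linked) =
  subst (_≤ lastOf h′ t) (sym (+-suc h _)) (≤-trans (+-monoˡ-≤ _ h<h′) (ascending-spread linked))

descending-spread : ∀ {h t} → Linked _>_ (h ∷ t) → lastOf h t + length t ≤ h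
descending-spread {h} [-]              = ≤-reflexive (+-identityʳ h)
descending-spread {h} (h>h′ ∷ linked) =
  subst (_≤ h) (sym (+-suc _ _)) (≤-trans (s≤s (descending-spread linked)) h>h′)

ascending-interval : ∀ lo b → Linked _<_ b → All (lo ≤_) b → All (_< lo + length b) b → b ≡ interval lo (length b)
ascending-interval lo []      _          _         _         = refl
ascending-interval lo (h ∷ t) ascending (lo≤h ∷ _) belowTop = cong₂ _∷_ h≡lo
  (ascending-interval (suc lo) t (Linked.tail ascending)
    (subst (λ l → All (l <_) t) h≡lo (linked-head <-trans ascending))
    (subst (λ l → All (_< l) t) (+-suc lo (length t)) (All.tail belowTop)))
  where
  h≡lo : h ≡ lo
  h≡lo = ≤-antisym (+-cancelʳ-≤ (length t) h lo (≤-pred (subst (h + length t <_) (+-suc lo (length t))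
           (≤-<-trans (ascending-spread ascending) (All-last belowTop)))))
         lo≤h

descending-interval : ∀ lo b → Linked _>_ b → All (lo ≤_) b → All (_< lo + length b) b →
  b ≡ reverse (interval lo (length b))
descending-interval lo []      _           _        _               = refl
descending-interval lo (h ∷ t) descending aboveBottom (h<top ∷ _) = trans (cong₂ _∷_ h≡top
  (descending-interval lo t (Linked.tail descending) (All.tail aboveBottom)
    (subst (λ l → All (_< l) t) h≡top (linked-head >-trans descending))))
  (sym (reverse-interval lo (length t)))
  where
  h≡top : h ≡ lo + length t
  h≡top = ≤-antisym (≤-pred (subst (h <_) (+-suc lo (length t)) h<top))
            (≤-trans (+-monoˡ-≤ (length t) (All-last aboveBottom)) (descending-spread descending))

perm-first : ∀ {a b v} → IsPerm (a ∷ b) → 1 ≤ v → v ≤ suc (length b) → All (v ≢_) b → a ≡ v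
perm-first π 1≤v v≤n v∉b with perm-complete π 1≤v v≤n
... | here v≡a   = sym v≡a
... | there v∈b = ⊥-elim (All.lookup v∉b v∈b refl)

largestFirst-ascending : ∀ {a b} → IsPerm (a ∷ b) → Linked _<_ b → All (_< a) b →
  a ∷ b ≡ nThenIncreasing (length (a ∷ b))
largestFirst-ascending {a} {b} π ascending allBelow =
  cong₂ _∷_ (perm-first π (s≤s z≤n) ≤-refl (All.map (λ y<a n≡y → <-irrefl (sym n≡y) (<-≤-trans y<a a≤n)) allBelow))
            (trans (ascending-interval 1 b ascending (All.tabulate (λ y∈ → proj₁ (perm-bounds π (there y∈))))
                                                    (All.map (λ y<a → <-≤-trans y<a a≤n) allBelow))
                   (sym (shiftedUpTo-interval 1 (length b))))
  where
  a≤n : a ≤ suc (length b)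
  a≤n = proj₂ (perm-bounds π (here refl))

smallestFirst-descending : ∀ {a b} → IsPerm (a ∷ b) → Linked _>_ b → All (a <_) b →
  a ∷ b ≡ oneThenDecreasing (length (a ∷ b))
smallestFirst-descending {a} {b} π descending allAbove =
  cong₂ _∷_ (perm-first π ≤-refl (s≤s z≤n) (All.map (λ a<y 1≡y → <-irrefl 1≡y (≤-<-trans 1≤a a<y)) allAbove))
            (trans (descending-interval 2 b descending (All.map (λ a<y → ≤-<-trans 1≤a a<y) allAbove)
                                                       (All.tabulate (λ y∈ → s≤s (proj₂ (perm-bounds π (there y∈))))))
                   (cong reverse (sym (shiftedUpTo-interval 2 (length b)))))
  where
  1≤a : 1 ≤ a
  1≤a = proj₁ (perm-bounds π (here refl))

Between : ℕ → ℕ → ℕ → Set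
Between a b y = (a < y × y < b) ⊎ (b < y × y < a)

-- If a < b starts a permutation and no entry lies strictly between them,
-- then b = a + 1, because a + 1 must be an entry.
successor-of-first : ∀ {a b r} → IsPerm (a ∷ b ∷ r) → a < b → All (λ y → ¬ (a < y × y < b)) r → b ≡ suc a
successor-of-first {a} {b} {r} π a<b noneBetween with b ≟ suc a
... | yes b≡a+1 = b≡a+1
... | no  b≢a+1 with perm-complete π (s≤s z≤n) (≤-trans a<b (proj₂ (perm-bounds π (there (here refl)))))
...   | here a+1≡a            = ⊥-elim (1+n≢n a+1≡a)
...   | there (here a+1≡b)    = ⊥-elim (b≢a+1 (sym a+1≡b))
...   | there (there a+1∈r) = ⊥-elim (All.lookup noneBetween a+1∈r (≤-refl , ≤∧≢⇒< a<b (≢-sym b≢a+1)))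

-- Nothing between a₁ and a₂ makes them consecutive; the case a₂ < a₁ is
-- the case a₁ < a₂ for the permutation a₂ a₁ ⋯ a_n.
noneBetween⇒consecutive : ∀ {a₁ a₂ r} → IsPerm (a₁ ∷ a₂ ∷ r) → All (λ y → ¬ Between a₁ a₂ y) r →
  FirstTwoConsecutive (a₁ ∷ a₂ ∷ r)
noneBetween⇒consecutive {a₁} {a₂} {r} π noneBetween with <-cmp a₁ a₂
... | tri< a₁<a₂ _ _ = a₁ , a₂ , r , refl ,
  inj₁ (successor-of-first π a₁<a₂ (All.map (λ notBetween → notBetween ∘ inj₁) noneBetween))
... | tri≈ _ a₁≡a₂ _ with (a₁≢a₂ ∷ _) ∷ _ ← perm-unique π = ⊥-elim (a₁≢a₂ a₁≡a₂)
... | tri> _ _ a₂<a₁ = a₁ , a₂ , r , refl ,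
  inj₂ (successor-of-first (↭-trans (↭-swap a₂ a₁ ↭-refl) π) a₂<a₁
         (All.map (λ notBetween → notBetween ∘ inj₂) noneBetween))

monotone⇒noneBetween : ∀ {a b r} → Linked _<_ (a ∷ b ∷ r) ⊎ Linked _>_ (a ∷ b ∷ r) → All (λ y → ¬ Between a b y) r
monotone⇒noneBetween (inj₁ (a<b ∷ ascending)) = All.map notBetween (linked-head <-trans ascending)
  where
  notBetween : ∀ {y} → _ < y → ¬ Between _ _ y
  notBetween b<y (inj₁ (_ , y<b))   = <-asym b<y y<b
  notBetween b<y (inj₂ (_ , y<a))   = <-asym a<b (<-trans b<y y<a)
monotone⇒noneBetween (inj₂ (a>b ∷ descending)) = All.map notBetween (linked-head >-trans descending)
  where
  notBetween : ∀ {y} → y < _ → ¬ Between _ _ y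
  notBetween y<b (inj₁ (a<y , _))   = <-asym a>b (<-trans a<y y<b)
  notBetween y<b (inj₂ (b<y , _))   = <-asym y<b b<y

lower-separates : ∀ {u v y} → u < y → y < v → lower u y ≢ lower v y
lower-separates {u} {v} {suc y} u<y y<v same =
  1+n≢n (sym (trans (sym (lower-above u<y)) (trans same (lower-notAbove (<-asym y<v)))))

sameLowering⇒noneBetween : ∀ {u v} r → map (lower u) r ≡ map (lower v) r → All (λ y → ¬ Between u v y) r
sameLowering⇒noneBetween []      _         = []
sameLowering⇒noneBetween (y ∷ r) sameImage with same ← ∷-injective sameImage =
  notBetween ∷ sameLowering⇒noneBetween r (proj₂ same)
  where
  notBetween : ¬ Between _ _ y
  notBetween (inj₁ (u<y , y<v)) = lower-separates u<y y<v (proj₁ same)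
  notBetween (inj₂ (v<y , y<u)) = lower-separates v<y y<u (sym (proj₁ same))

sameLowering⇒above : ∀ {u v y} → lower u y ≡ lower v y → v ≢ y → u < y → v < y
sameLowering⇒above {u} {v} {y} same v≢y u<y with <-cmp v y
... | tri< v<y _ _   = v<y
... | tri≈ _ v≡y _   = ⊥-elim (v≢y v≡y)
... | tri> _ _ y<v   = ⊥-elim (lower-separates u<y y<v same)

sameLowering⇒below : ∀ {u v y} → lower u y ≡ lower v y → u ≢ y → v ≢ y → y < u → y < v
sameLowering⇒below {u} {v} {y} same u≢y v≢y y<u with <-cmp v y
... | tri< v<y _ _   = ⊥-elim (<-asym y<u (sameLowering⇒above (sym same) u≢y v<y))
... | tri≈ _ v≡y _   = ⊥-elim (v≢y v≡y)
... | tri> _ _ y<v   = y<v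

twoOfThreeCoincide : ∀ {A : Set} {x y z a b : A} → (x ≡ a) ⊎ (x ≡ b) → (y ≡ a) ⊎ (y ≡ b) → (z ≡ a) ⊎ (z ≡ b) →
  (x ≡ y) ⊎ ((x ≡ z) ⊎ (y ≡ z))
twoOfThreeCoincide (inj₁ x≡a) (inj₁ y≡a) _          = inj₁ (trans x≡a (sym y≡a))
twoOfThreeCoincide (inj₂ x≡b) (inj₂ y≡b) _          = inj₁ (trans x≡b (sym y≡b))
twoOfThreeCoincide (inj₁ x≡a) (inj₂ _)   (inj₁ z≡a) = inj₂ (inj₁ (trans x≡a (sym z≡a)))
twoOfThreeCoincide (inj₁ _)   (inj₂ y≡b) (inj₂ z≡b) = inj₂ (inj₂ (trans y≡b (sym z≡b)))
twoOfThreeCoincide (inj₂ _)   (inj₁ y≡a) (inj₁ z≡a) = inj₂ (inj₂ (trans y≡a (sym z≡a)))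
twoOfThreeCoincide (inj₂ x≡b) (inj₁ _)   (inj₂ z≡b) = inj₂ (inj₁ (trans x≡b (sym z≡b)))

Conclusion : List ℕ → Set
Conclusion τ = FirstTwoConsecutive τ ⊎ ((τ ≡ oneThenDecreasing (length τ)) ⊎ (τ ≡ nThenIncreasing (length τ)))

-- The three entries of τ = a₁ a₂ ⋯ a_n whose deletion leaves a
-- quasi-consecutive pattern: the first, the second and the last.
deleteFirst deleteSecond deleteLast : ℕ → ℕ → List ℕ → List ℕ
deleteFirst  a₁ a₂ r = map (lower a₁) (a₂ ∷ r)
deleteSecond a₁ a₂ r = map (lower a₂) (a₁ ∷ r)
deleteLast   a₁ a₂ r = map (lower (lastOf a₂ r)) (a₁ ∷ dropLast a₂ r)

module Deletions {a₁ a₂ r} (π : IsPerm (a₁ ∷ a₂ ∷ r)) where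

  a₁≢rest : All (a₁ ≢_) (a₂ ∷ r)
  a₁≢rest with a₁≢ ∷ _ ← perm-unique π = a₁≢

  a₂≢rest : All (a₂ ≢_) (a₁ ∷ r)
  a₂≢rest with (a₁≢a₂ ∷ _) ∷ a₂≢ ∷ _ ← perm-unique π = ≢-sym a₁≢a₂ ∷ a₂≢

  last≢rest : All (lastOf a₂ r ≢_) (a₁ ∷ dropLast a₂ r)
  last≢rest = unique-last (a₁ ∷ dropLast a₂ r) (subst Unique (cong (a₁ ∷_) (dropLast-lastOf a₂ r)) (perm-unique π))

  coversFirst : Covers (a₁ ∷ a₂ ∷ r) (deleteFirst a₁ a₂ r)
  coversFirst = deletion-covered [] a₁ (a₂ ∷ r) π
    (lowering-occurs a₁ (s≤s (s≤s z≤n)) ≤-refl refl (sym (++-identityʳ r)) a₁≢rest)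

  coversSecond : Covers (a₁ ∷ a₂ ∷ r) (deleteSecond a₁ a₂ r)
  coversSecond = deletion-covered [ a₁ ] a₂ r π
    (lowering-occurs a₂ (s≤s z≤n) ≤-refl refl (sym (++-identityʳ r)) a₂≢rest)

  coversLast : Covers (a₁ ∷ a₂ ∷ r) (deleteLast a₁ a₂ r)
  coversLast = subst₂ Covers (sym τ≡) (cong (map (lower z)) (++-identityʳ (a₁ ∷ w)))
    (deletion-covered (a₁ ∷ w) z [] (subst IsPerm τ≡ π)
      (subst₂ _≼_ (cong (map (lower z)) (sym (++-identityʳ (a₁ ∷ w)))) τ≡
        (lowering-occurs z (s≤s z≤n) (s≤s (≤-trans (≤-reflexive (length-dropLast a₂ r)) (n≤1+n _)))
          refl (dropLast-lastOf a₂ r) last≢rest)))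
    where
    w = dropLast a₂ r
    z = lastOf a₂ r
    τ≡ : a₁ ∷ a₂ ∷ r ≡ (a₁ ∷ w) ++ [ z ]
    τ≡ = cong (a₁ ∷_) (dropLast-lastOf a₂ r)

  twoDeletionsCoincide : CoversExactlyTwo (a₁ ∷ a₂ ∷ r) →
    (deleteFirst a₁ a₂ r ≡ deleteSecond a₁ a₂ r) ⊎
      ((deleteFirst a₁ a₂ r ≡ deleteLast a₁ a₂ r) ⊎ (deleteSecond a₁ a₂ r ≡ deleteLast a₁ a₂ r))
  twoDeletionsCoincide (_ , _ , _ , _ , _ , onlyTwo) =
    twoOfThreeCoincide (onlyTwo _ coversFirst) (onlyTwo _ coversSecond) (onlyTwo _ coversLast)

  -- Deleting a₁ or a₂ gives the same pattern: nothing lies between a₁ and a₂.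
  firstEqualsSecond : deleteFirst a₁ a₂ r ≡ deleteSecond a₁ a₂ r → FirstTwoConsecutive (a₁ ∷ a₂ ∷ r)
  firstEqualsSecond same = noneBetween⇒consecutive π (sameLowering⇒noneBetween r (proj₂ (∷-injective same)))

  -- Deleting a₁ or a_n gives the same pattern: τ is ordered like its shift,
  -- hence monotone, and again nothing lies between a₁ and a₂.
  firstEqualsLast : deleteFirst a₁ a₂ r ≡ deleteLast a₁ a₂ r → FirstTwoConsecutive (a₁ ∷ a₂ ∷ r)
  firstEqualsLast same = noneBetween⇒consecutive π (monotone⇒noneBetween (shifted-monotone a₁≢rest
    (sameImage⇒ordIso (lower-embedding a₁) (lower-embedding (lastOf a₂ r)) a₁≢rest last≢rest same)))

  -- Deleting a₂ or a_n gives the same pattern: a₂ ⋯ a_n is monotone and a₁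
  -- lies on the same side of a₂ as of a_n.  If a₁ continues the monotone run
  -- we are in case (i); otherwise a₁ is the largest or smallest entry.
  secondEqualsLast : deleteSecond a₁ a₂ r ≡ deleteLast a₁ a₂ r → Conclusion (a₁ ∷ a₂ ∷ r)
  secondEqualsLast same with sameFirst , sameRest ← ∷-injective same
    with shifted-monotone (All.tail a₂≢rest)
           (sameImage⇒ordIso (lower-embedding a₂) (lower-embedding (lastOf a₂ r))
                             (All.tail a₂≢rest) (All.tail last≢rest) sameRest)
       | <-cmp a₁ a₂
  ... | _               | tri≈ _ a₁≡a₂ _ = ⊥-elim (All.head a₂≢rest (sym a₁≡a₂))
  ... | inj₁ ascending  | tri< a₁<a₂ _ _ =
    inj₁ (noneBetween⇒consecutive π (monotone⇒noneBetween (inj₁ (a₁<a₂ ∷ ascending))))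
  ... | inj₂ descending | tri> _ _ a₂<a₁ =
    inj₁ (noneBetween⇒consecutive π (monotone⇒noneBetween (inj₂ (a₂<a₁ ∷ descending))))
  ... | inj₁ ascending  | tri> _ _ a₂<a₁ =
    inj₂ (inj₂ (largestFirst-ascending π ascending
      (All.map (λ y≤last → ≤-<-trans y≤last last<a₁) (linked-last <⇒≤ ≤-trans ≤-refl ascending))))
    where
    last<a₁ : lastOf a₂ r < a₁
    last<a₁ = sameLowering⇒above sameFirst (All.head last≢rest) a₂<a₁
  ... | inj₂ descending | tri< a₁<a₂ _ _ =
    inj₂ (inj₁ (smallestFirst-descending π descending
      (All.map (λ last≤y → <-≤-trans a₁<last last≤y)
        (linked-last {S = λ y l → l ≤ y} <⇒≤ (λ b≤a c≤b → ≤-trans c≤b b≤a) ≤-refl descending))))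
    where
    a₁<last : a₁ < lastOf a₂ r
    a₁<last = sameLowering⇒below sameFirst (All.head a₂≢rest) (All.head last≢rest) a₁<a₂

proposition4p2 : (τ : List ℕ) → IsPerm τ → CoversExactlyTwo τ →
    FirstTwoConsecutive τ ⊎
      ((τ ≡ oneThenDecreasing (length τ)) ⊎ (τ ≡ nThenIncreasing (length τ)))
-- The empty permutation covers nothing, and 1 = 1 n (n-1) ⋯ 2 for n = 1.
proposition4p2 [] _ ([] , _ , _ , (_ , _ , []≢[] , _) , _) = ⊥-elim ([]≢[] refl)
proposition4p2 [] _ ((s ∷ σ) , _ , _ , (_ , s∷σ≼[] , _) , _) = ⊥-elim (n≮0 (occurs-length (s ∷ σ) [] s∷σ≼[]))
proposition4p2 (x ∷ []) π _ with 1≤x , x≤1 ← perm-bounds π (here refl) =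
  inj₂ (inj₁ (cong [_] (≤-antisym x≤1 1≤x)))
proposition4p2 (a₁ ∷ a₂ ∷ r) π exactlyTwo with Deletions.twoDeletionsCoincide π exactlyTwo
... | inj₁ first≡second         = inj₁ (Deletions.firstEqualsSecond π first≡second)
... | inj₂ (inj₁ first≡last)    = inj₁ (Deletions.firstEqualsLast π first≡last)
... | inj₂ (inj₂ second≡last)   = Deletions.secondEqualsLast π second≡last
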